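{- Let $G$ be a graph with ${\rm diam}(G)=3$ and let $\mathcal{I}$ be the set of all maximal independent sets of $G$. Then $\Gamma_{\rho}(G)=|V(G)|-m(G)+2$, where $$m(G)=\min_{A\in\mathcal{I}}\{|A|+|Q| : Q\text{ is a maximal clique of minimum cardinality of } D(G)-A\}.$$
   Context: Graphs are finite and simple; $d(u,v)$ is the distance in $G$. Two vertices $x,y$ form a diametrical pair if $d(x,y)={\rm diam}(G)$. The diametrical graph $D(G)$ has vertex set $V(G)$, with $x,y$ adjacent iff they form a diametrical pair of $G$; $D(G)-A$ is obtained by deleting the vertices of $A$. A maximal clique is a clique not contained in a larger clique. A packing coloring $c:V(G)\to\{1,\dots,k\}$ satisfies: $c(u)=c(v)=i$, $u\ne v$, implies $d(u,v)>i$. The Grundy packing chromatic number $\Gamma_{\rho}(G)$ is the maximum number of colors $k$ in a packing coloring $c:V(G)\to\{1,\dots,k\}$ using all $k$ colors in which every vertex $v$ with $c(v)=i$ has, for every $j\in\{1,\dots,i-1\}$, a vertex $u$ with $c(u)=j$ and $d(u,v)\le j$ (equivalently, the maximum number of colors produced by the greedy procedure that processes vertices in some order and assigns each vertex the smallest color $i$ with no already-colored vertex of color $i$ at distance at most $i$). -}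

module Defs where

open import Data.Nat using (ℕ; zero; suc; _≤_; _<_; _+_)
open import Data.Bool using (Bool; true; false)
open import Data.Fin using (Fin)
open import Data.Fin.Subset using (Subset; _∈_; _∉_; _⊆_; ∣_∣)
open import Data.Product using (Σ; ∃; ∃-syntax; _×_; _,_)
open import Relation.Binary.PropositionalEquality using (_≡_; _≢_)
open import Relation.Nullary using (¬_)

record Graph : Set where
  field
    n     : ℕ
    adj   : Fin n → Fin n → Bool
    sym   : ∀ u v → adj u v ≡ adj v u
    irref : ∀ u → adj u u ≡ false

open Graph public

V : Graph → Set
V G = Fin (n G)

Edge : (G : Graph) → V G → V G → Set
Edge G u v = adj G u v ≡ true

data Walk (G : Graph) : ℕ → V G → V G → Set where
  here : ∀ {u} → Walk G 0 u u
  step : ∀ {k u w v} → Edge G u w → Walk G k w v → Walk G (suc k) u v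

Dist≤ : (G : Graph) → ℕ → V G → V G → Set
Dist≤ G i u v = ∃[ j ] (j ≤ i × Walk G j u v)

Dist : (G : Graph) → V G → V G → ℕ → Set
Dist G u v k = Dist≤ G k u v × (∀ j → Dist≤ G j u v → k ≤ j)

Diam : Graph → ℕ → Set
Diam G D = (∀ u v → ∃[ j ] (j ≤ D × Dist G u v j))
         × (∃[ u ] ∃[ v ] Dist G u v D)

-- x,y form a diametrical pair: d(x,y) = diam(G); i.e. x,y adjacent in D(G).
DiamPair : (G : Graph) → V G → V G → Set
DiamPair G x y = ∃[ D ] (Diam G D × Dist G x y D)

Independent : (G : Graph) → Subset (n G) → Set
Independent G A = ∀ x y → x ∈ A → y ∈ A → adj G x y ≡ false

MaximalIndependent : (G : Graph) → Subset (n G) → Set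
MaximalIndependent G A =
  Independent G A × (∀ B → Independent G B → A ⊆ B → B ⊆ A)

CliqueDminus : (G : Graph) → Subset (n G) → Subset (n G) → Set
CliqueDminus G A Q =
  (∀ x → x ∈ Q → x ∉ A) × (∀ x y → x ∈ Q → y ∈ Q → x ≢ y → DiamPair G x y)

MaximalCliqueDminus : (G : Graph) → Subset (n G) → Subset (n G) → Set
MaximalCliqueDminus G A Q =
  CliqueDminus G A Q × (∀ Q' → CliqueDminus G A Q' → Q ⊆ Q' → Q' ⊆ Q)

MinMaximalCliqueDminus : (G : Graph) → Subset (n G) → Subset (n G) → Set
MinMaximalCliqueDminus G A Q =
  MaximalCliqueDminus G A Q × (∀ Q' → MaximalCliqueDminus G A Q' → ∣ Q ∣ ≤ ∣ Q' ∣)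

IsM : Graph → ℕ → Set
IsM G m =
  (∃[ A ] ∃[ Q ] (MaximalIndependent G A × MinMaximalCliqueDminus G A Q
                   × ∣ A ∣ + ∣ Q ∣ ≡ m))
  × (∀ A Q → MaximalIndependent G A → MinMaximalCliqueDminus G A Q
       → m ≤ ∣ A ∣ + ∣ Q ∣)

ColoringWith : (G : Graph) → ℕ → (V G → ℕ) → Set
ColoringWith G k c =
  (∀ v → 1 ≤ c v × c v ≤ k) × (∀ i → 1 ≤ i → i ≤ k → ∃[ v ] c v ≡ i)

Packing : (G : Graph) → (V G → ℕ) → Set
Packing G c = ∀ u v → u ≢ v → c u ≡ c v → ¬ Dist≤ G (c u) u v

GrundyCond : (G : Graph) → (V G → ℕ) → Set
GrundyCond G c =
  ∀ v j → 1 ≤ j → j < c v → ∃[ u ] (c u ≡ j × Dist≤ G j u v)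

GrundyPackingColoring : (G : Graph) → ℕ → (V G → ℕ) → Set
GrundyPackingColoring G k c = ColoringWith G k c × Packing G c × GrundyCond G c

IsGrundyPackingNumber : Graph → ℕ → Set
IsGrundyPackingNumber G k =
  (∃[ c ] GrundyPackingColoring G k c)
  × (∀ k' c' → GrundyPackingColoring G k' c' → k' ≤ k)

-- In a graph of diameter 3 any two vertices are within distance 3, so in a packing
-- coloring every color i ≥ 3 is used at most once, and the Grundy condition for colors
-- i ≥ 3 holds automatically. A Grundy packing coloring is therefore determined, up to the
-- order of the colors ≥ 3, by A = c⁻¹(1) and Q = c⁻¹(2): packing and the Grundy condition
-- for color 1 say that A is a maximal independent set, and for color 2 (diametrical
-- meaning "at distance more than 2") that Q is a maximal clique of D(G) - A. Conversely
-- every such pair (A, Q) extends, by distinct colors 3, 4, … on the remaining vertices, to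
-- a Grundy packing coloring with |V| - |A| - |Q| + 2 colors. Maximising the latter is
-- minimising |A| + |Q|, and shrinking Q to a maximal clique of minimum size only helps.

module Submission where

open import Data.Bool.Base using (true; false)
open import Data.Bool.Properties using (not-¬; ¬-not) renaming (_≟_ to _≟ᵇ_)
open import Data.Fin.Base using (Fin; zero; suc; toℕ; fromℕ<)
open import Data.Fin.Properties using (any?; toℕ-injective; toℕ<n; fromℕ<-injective; injective⇒≤)
  renaming (_≟_ to _≟ᶠ_)
open import Data.Fin.Subset
  using (Subset; inside; outside; _∈_; _∉_; _⊆_; _∪_; ∁; ⁅_⁆; ∣_∣; Nonempty)
open import Data.Fin.Subset.Properties
  using (_∈?_; x∈p∪q⁻; x∈p∪q⁺; p⊆p∪q; x∈⁅x⁆; x∈⁅y⁆⇒x≡y; x∈∁p⇒x∉p; x∉p⇒x∈∁p; ∣∁p∣≡n∸∣p∣)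
open import Data.Nat.Base using (ℕ; zero; suc; _+_; _∸_; _≤_; _<_; z≤n; s≤s)
open import Data.Nat.Induction using (<-wellFounded)
open import Data.Nat.Properties
  using (_≤?_; ≤-refl; ≤-trans; ≤-antisym; 1+n≰n; <⇒≤; <-irrefl; ≮⇒≥; ≰⇒>; ≤∧≢⇒<;
         +-suc; +-comm; +-cancelˡ-≡;         +-monoʳ-≤; ∸-monoʳ-≤; m≤n+m∸n; suc-injective; module ≤-Reasoning)
  renaming (_≟_ to _≟ⁿ_)
open import Data.Product.Base using (∃-syntax; _×_; _,_; proj₁; proj₂)
open import Data.Sum.Base using (_⊎_; inj₁; inj₂; [_,_]′; map₂)
open import Data.Vec.Base using ([]; _∷_; here; there)
open import Function.Base using (_∘_)
open import Function.Definitions using (Injective)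
open import Induction.WellFounded using (Acc; acc)
open import Level using (Level)
open import Relation.Binary.Definitions using (Symmetric)
open import Relation.Binary.PropositionalEquality
  using (_≡_; _≢_; refl; sym; trans; cong; subst; module ≡-Reasoning)
open import Relation.Nullary.Decidable using (Dec; yes; no; does; map′; _×-dec_; decidable-stable)
open import Relation.Nullary.Negation using (¬_; contradiction)
open import Relation.Unary using (Pred; Decidable)

open import Defs renaming (sym to adj-sym)

private
  variable
    ℓ : Level
    m N : ℕ
    p q : Subset N
    x y : Fin N

m<n∸o⇒o+m<n : ∀ o n {m} → m < n ∸ o → o + m < n
m<n∸o⇒o+m<n zero    n       m<n   = m<n
m<n∸o⇒o+m<n (suc o) (suc n) m<n∸o = s≤s (m<n∸o⇒o+m<n o n m<n∸o)

rank : Subset N → Fin N → ℕ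
rank (_       ∷ p) zero    = 0
rank (outside ∷ p) (suc x) = rank p x
rank (inside  ∷ p) (suc x) = suc (rank p x)

rank<∣p∣ : x ∈ p → rank p x < ∣ p ∣
rank<∣p∣ {p = inside  ∷ p} here        = s≤s z≤n
rank<∣p∣ {p = outside ∷ p} (there x∈p) = rank<∣p∣ x∈p
rank<∣p∣ {p = inside  ∷ p} (there x∈p) = s≤s (rank<∣p∣ x∈p)

rank-injective : x ∈ p → y ∈ p → rank p x ≡ rank p y → x ≡ y
rank-injective                   here        here        _  = refl
rank-injective {p = inside  ∷ p} here        (there _)   ()
rank-injective {p = inside  ∷ p} (there _)   here        ()
rank-injective {p = outside ∷ p} (there x∈p) (there y∈p) eq = cong suc (rank-injective x∈p y∈p eq)
rank-injective {p = inside  ∷ p} (there x∈p) (there y∈p) eq =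
  cong suc (rank-injective x∈p y∈p (suc-injective eq))

rank-surjective : ∀ {i} → i < ∣ p ∣ → ∃[ x ] (x ∈ p × rank p x ≡ i)
rank-surjective {p = inside ∷ p} {zero} _ = zero , here , refl
rank-surjective {p = inside ∷ p} {suc i} (s≤s i<∣p∣) with rank-surjective {p = p} i<∣p∣
... | x , x∈p , refl = suc x , there x∈p , refl
rank-surjective {p = outside ∷ p} i<∣p∣ with rank-surjective {p = p} i<∣p∣
... | x , x∈p , refl = suc x , there x∈p , refl

injective⇒≤∣p∣ : (f : Fin m → Fin N) → Injective _≡_ _≡_ f → (∀ i → f i ∈ p) → m ≤ ∣ p ∣
injective⇒≤∣p∣ {p = p} f f-injective f∈p = injective⇒≤ rank∘f-injective
  where
  rank∘f : Fin _ → Fin ∣ p ∣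
  rank∘f i = fromℕ< (rank<∣p∣ (f∈p i))

  rank∘f-injective : Injective _≡_ _≡_ rank∘f
  rank∘f-injective {i} {j} eq =
    f-injective (rank-injective (f∈p i) (f∈p j) (fromℕ<-injective _ _ _ _ eq))

∣p∪q∣≡∣p∣+∣q∣ : (∀ {x} → x ∈ p → x ∉ q) → ∣ p ∪ q ∣ ≡ ∣ p ∣ + ∣ q ∣
∣p∪q∣≡∣p∣+∣q∣ {p = []}          {[]}          _        = refl
∣p∪q∣≡∣p∣+∣q∣ {p = inside  ∷ p} {inside  ∷ q} disjoint = contradiction here (disjoint here)
∣p∪q∣≡∣p∣+∣q∣ {p = inside  ∷ p} {outside ∷ q} disjoint =
  cong suc (∣p∪q∣≡∣p∣+∣q∣ (λ x∈p → disjoint (there x∈p) ∘ there))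
∣p∪q∣≡∣p∣+∣q∣ {p = outside ∷ p} {inside  ∷ q} disjoint =
  trans (cong suc (∣p∪q∣≡∣p∣+∣q∣ (λ x∈p → disjoint (there x∈p) ∘ there))) (sym (+-suc ∣ p ∣ ∣ q ∣))
∣p∪q∣≡∣p∣+∣q∣ {p = outside ∷ p} {outside ∷ q} disjoint =
  ∣p∪q∣≡∣p∣+∣q∣ (λ x∈p → disjoint (there x∈p) ∘ there)

∣∁[p∪q]∣≡n∸[∣p∣+∣q∣] : {p q : Subset N} → (∀ {x} → x ∈ p → x ∉ q) →
                       ∣ ∁ (p ∪ q) ∣ ≡ N ∸ (∣ p ∣ + ∣ q ∣)
∣∁[p∪q]∣≡n∸[∣p∣+∣q∣] {N = N} {p = p} {q = q} disjoint =
  trans (∣∁p∣≡n∸∣p∣ (p ∪ q)) (cong (N ∸_) (∣p∪q∣≡∣p∣+∣q∣ disjoint))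

subsetOf : {P : Pred (Fin N) ℓ} → Decidable P → Subset N
subsetOf {N = zero}  P? = []
subsetOf {N = suc N} P? = does (P? zero) ∷ subsetOf (P? ∘ suc)

∈-subsetOf⁺ : {P : Pred (Fin N) ℓ} (P? : Decidable P) → P x → x ∈ subsetOf P?
∈-subsetOf⁺ {x = zero} P? Px with P? zero
... | yes _  = here
... | no ¬Px = contradiction Px ¬Px
∈-subsetOf⁺ {x = suc x} P? Px = there (∈-subsetOf⁺ (P? ∘ suc) Px)

∈-subsetOf⁻ : {P : Pred (Fin N) ℓ} (P? : Decidable P) → x ∈ subsetOf P? → P x
∈-subsetOf⁻ {x = zero} P? x∈ with P? zero
... | yes Px = Px
∈-subsetOf⁻ {x = suc x} P? (there x∈) = ∈-subsetOf⁻ (P? ∘ suc) x∈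

Minimum : (Subset N → Set ℓ) → Subset N → Set ℓ
Minimum P q = P q × (∀ r → P r → ∣ q ∣ ≤ ∣ r ∣)

-- Without decidability of P a minimum cannot be computed, but its double negation
-- suffices for decidable goals such as inequalities on ℕ.
¬¬-minimum : (P : Subset N → Set ℓ) → P p → ¬ ¬ (∃[ q ] (Minimum P q × ∣ q ∣ ≤ ∣ p ∣))
¬¬-minimum {p = p} P Pp = search p (<-wellFounded ∣ p ∣) Pp
  where
  search : ∀ p → Acc _<_ ∣ p ∣ → P p → ¬ ¬ (∃[ q ] (Minimum P q × ∣ q ∣ ≤ ∣ p ∣))
  search p (acc smaller) Pp none = none (p , (Pp , p-minimum) , ≤-refl)
    where
    p-minimum : ∀ r → P r → ∣ p ∣ ≤ ∣ r ∣
    p-minimum r Pr = ≮⇒≥ λ r<p →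
      search r (smaller r<p) Pr λ (q , q-min , q≤r) → none (q , q-min , ≤-trans q≤r (<⇒≤ r<p))

Pairwise : (Fin N → Fin N → Set ℓ) → Subset N → Set ℓ
Pairwise R p = ∀ x y → x ∈ p → y ∈ p → R x y

∈∪⁅⁆⁻ : y ∈ p ∪ ⁅ x ⁆ → y ∈ p ⊎ y ≡ x
∈∪⁅⁆⁻ {p = p} {x = x} = map₂ (x∈⁅y⁆⇒x≡y x) ∘ x∈p∪q⁻ p ⁅ x ⁆

pairwise-∪⁅⁆ : {R : Fin N → Fin N → Set ℓ} → Symmetric R → R x x →
               Pairwise R p → (∀ y → y ∈ p → R y x) → Pairwise R (p ∪ ⁅ x ⁆)
pairwise-∪⁅⁆ R-sym Rxx Rp Rpx y z y∈ z∈ with ∈∪⁅⁆⁻ y∈ | ∈∪⁅⁆⁻ z∈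
... | inj₁ y∈p | inj₁ z∈p = Rp y z y∈p z∈p
... | inj₁ y∈p | inj₂ refl = Rpx y y∈p
... | inj₂ refl | inj₁ z∈p = R-sym (Rpx z z∈p)
... | inj₂ refl | inj₂ refl = Rxx

∈-maximal : (P : Subset N → Set ℓ) → (∀ q → P q → p ⊆ q → q ⊆ p) → P (p ∪ ⁅ x ⁆) → x ∈ p
∈-maximal {p = p} {x = x} P p-maximal P[p∪⁅x⁆] =
  p-maximal (p ∪ ⁅ x ⁆) P[p∪⁅x⁆] (p⊆p∪q ⁅ x ⁆) (x∈p∪q⁺ (inj₂ (x∈⁅x⁆ x)))

module _ {G : Graph} where

  private
    variable
      i j k : ℕ
      u v w : V G
      A Q : Subset (n G)

  walk-snoc : Walk G k u v → Edge G v w → Walk G (suc k) u w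
  walk-snoc here         e = step e here
  walk-snoc (step e′ wk) e = step e′ (walk-snoc wk e)

  walk-reverse : Walk G k u v → Walk G k v u
  walk-reverse here                         = here
  walk-reverse (step {u = u} {w = w} e wk) = walk-snoc (walk-reverse wk) (trans (adj-sym G w u) e)

  Dist≤-sym : Dist≤ G i u v → Dist≤ G i v u
  Dist≤-sym (j , j≤i , wk) = j , j≤i , walk-reverse wk

  Dist≤-mono : i ≤ j → Dist≤ G i u v → Dist≤ G j u v
  Dist≤-mono i≤j (k , k≤i , wk) = k , ≤-trans k≤i i≤j , wk

  Edge⇒Dist≤1 : Edge G u v → Dist≤ G 1 u v
  Edge⇒Dist≤1 e = 1 , ≤-refl , step e here

  Dist≤0⇒≡ : Dist≤ G 0 u v → u ≡ v
  Dist≤0⇒≡ (zero , _ , here) = refl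

  Dist≤1⇒Edge : u ≢ v → Dist≤ G 1 u v → Edge G u v
  Dist≤1⇒Edge u≢v (zero , _ , here)          = contradiction refl u≢v
  Dist≤1⇒Edge u≢v (suc zero , _ , step e here) = e
  Dist≤1⇒Edge u≢v (suc (suc _) , s≤s () , _)

  Dist-unique : Dist G u v i → Dist G u v j → i ≡ j
  Dist-unique (di , i-min) (dj , j-min) = ≤-antisym (i-min _ dj) (j-min _ di)

  Dist⇒≤diam : Diam G j → Dist G u v i → i ≤ j
  Dist⇒≤diam {u = u} {v} (bounded , _) duv = let k , k≤j , duv′ = bounded u v in
    subst (_≤ _) (Dist-unique duv′ duv) k≤j

  Diam-unique : Diam G i → Diam G j → i ≡ j
  Diam-unique diam-i@(_ , _ , _ , d-i) diam-j@(_ , _ , _ , d-j) =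
    ≤-antisym (Dist⇒≤diam diam-j d-i) (Dist⇒≤diam diam-i d-j)

  Dist-suc⇒Edge : Dist G u v (suc i) → ∃[ w ] Edge G u w
  Dist-suc⇒Edge ((_ , _ , step e _) , _)   = _ , e
  Dist-suc⇒Edge ((_ , _ , here) , minimal) with minimal 0 (0 , z≤n , here)
  ... | ()

  maximalIndependent⇒dominating : MaximalIndependent G A → v ∉ A → ∃[ u ] (u ∈ A × Edge G u v)
  maximalIndependent⇒dominating {A} {v} (A-independent , A-maximal) v∉A
    with any? (λ u → u ∈? A ×-dec (adj G u v ≟ᵇ true))
  ... | yes dominated = dominated
  ... | no undominated = contradiction (∈-maximal (Independent G) A-maximal extended) v∉A
    where
    extended : Independent G (A ∪ ⁅ v ⁆)
    extended = pairwise-∪⁅⁆ (λ {x} {y} e → trans (adj-sym G y x) e) (irref G v) A-independent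
                            (λ u u∈A → ¬-not (λ e → undominated (u , u∈A , e)))

  maximalIndependent-nonempty : MaximalIndependent G A → V G → Nonempty A
  maximalIndependent-nonempty {A} A-max v with v ∈? A
  ... | yes v∈A = v , v∈A
  ... | no v∉A  = let u , u∈A , _ = maximalIndependent⇒dominating A-max v∉A in u , u∈A

  Packing⇒apart : ∀ {c} → Packing G c → c u ≡ i → c v ≡ i → u ≢ v → ¬ Dist≤ G i u v
  Packing⇒apart packing refl cv≡cu u≢v = packing _ _ u≢v (sym cv≡cu)

  classes⇒packing : ∀ {c} →
    (∀ u v → c u ≡ 1 → c v ≡ 1 → adj G u v ≡ false) →
    (∀ u v → u ≢ v → c u ≡ 2 → c v ≡ 2 → ¬ Dist≤ G 2 u v) →
    (∀ u v i → c u ≡ 3 + i → c v ≡ 3 + i → u ≡ v) →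
    Packing G c
  classes⇒packing {c} class₁ class₂ class₃ u v u≢v same d with c u in cu
  ... | zero              = u≢v (Dist≤0⇒≡ d)
  ... | 1                 = not-¬ (Dist≤1⇒Edge u≢v d) (class₁ u v cu (sym same))
  ... | 2                 = class₂ u v u≢v cu (sym same) d
  ... | suc (suc (suc i)) = u≢v (class₃ u v i cu (sym same))

  IsM⇒m≤∣A∣+∣Q∣ : ∀ {m} → IsM G m → MaximalIndependent G A → MaximalCliqueDminus G A Q →
                  m ≤ ∣ A ∣ + ∣ Q ∣
  IsM⇒m≤∣A∣+∣Q∣ {A} (_ , m-minimal) A-max Q-max = decidable-stable (_ ≤? _) λ m≰ →
    ¬¬-minimum (MaximalCliqueDminus G A) Q-max λ (Q* , Q*-min , ∣Q*∣≤∣Q∣) →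
      m≰ (≤-trans (m-minimal A Q* A-max Q*-min) (+-monoʳ-≤ ∣ A ∣ ∣Q*∣≤∣Q∣))

module Diameter {G : Graph} {d : ℕ} (diam : Diam G (suc d)) where

  private
    variable
      u v : V G
      A Q : Subset (n G)

  within-diam : ∀ u v → Dist≤ G (suc d) u v
  within-diam u v = let j , j≤1+d , (dj , _) = proj₁ diam u v in Dist≤-mono j≤1+d dj

  Dist≤? : ∀ i u v → Dec (Dist≤ G i u v)
  Dist≤? i u v = let j , _ , (dj , j-min) = proj₁ diam u v in
    map′ (λ j≤i → Dist≤-mono j≤i dj) (j-min i) (j ≤? i)

  DiamPair⇒far : DiamPair G u v → ¬ Dist≤ G d u v
  DiamPair⇒far (D , diam′ , _ , D-min) close with Diam-unique diam′ diam
  ... | refl = 1+n≰n (D-min d close)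

  far⇒DiamPair : ¬ Dist≤ G d u v → DiamPair G u v
  far⇒DiamPair {u} {v} far with proj₁ diam u v
  ... | j , j≤1+d , dj = suc d , diam , subst (Dist G u v) j≡1+d dj
    where
    j≡1+d : j ≡ suc d
    j≡1+d = ≤-antisym j≤1+d (≰⇒> λ j≤d → far (Dist≤-mono j≤d (proj₁ dj)))

  DiamPair-sym : DiamPair G u v → DiamPair G v u
  DiamPair-sym = far⇒DiamPair ∘ (_∘ Dist≤-sym) ∘ DiamPair⇒far

  maximalClique⇒near : MaximalCliqueDminus G A Q → v ∉ A → v ∉ Q → ∃[ u ] (u ∈ Q × Dist≤ G d u v)
  maximalClique⇒near {A} {Q} {v} ((Q∩A=∅ , Q-clique) , Q-maximal) v∉A v∉Q
    with any? (λ u → u ∈? Q ×-dec Dist≤? d u v)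
  ... | yes near = near
  ... | no none  = contradiction (∈-maximal (CliqueDminus G A) Q-maximal extended) v∉Q
    where
    extended : CliqueDminus G A (Q ∪ ⁅ v ⁆)
    extended = (λ x → [ Q∩A=∅ x , (λ { refl → v∉A }) ]′ ∘ ∈∪⁅⁆⁻)
             , pairwise-∪⁅⁆ (λ pair y≢x → DiamPair-sym (pair (y≢x ∘ sym)))
                            (λ v≢v → contradiction refl v≢v) Q-clique (λ u u∈Q _ → far⇒DiamPair (λ close → none (u , u∈Q , close)))

  maximalClique-nonempty : MaximalCliqueDminus G A Q → v ∉ A → Nonempty Q
  maximalClique-nonempty {Q = Q} {v} Q-max v∉A with v ∈? Q
  ... | yes v∈Q = v , v∈Q
  ... | no v∉Q  = let u , u∈Q , _ = maximalClique⇒near Q-max v∉A v∉Q in u , u∈Q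

  vertex : V G
  vertex = proj₁ (proj₂ diam)

  independent⇒∃∉ : Independent G A → ∃[ v ] v ∉ A
  independent⇒∃∉ {A} A-independent with proj₂ diam
  ... | u , _ , du with Dist-suc⇒Edge du | u ∈? A
  ...   | _ , _ | no u∉A  = u , u∉A
  ...   | w , e | yes u∈A = w , λ w∈A → not-¬ e (A-independent u w u∈A w∈A)

module LowerBound {G : Graph} (diam : Diam G 3) {A Q : Subset (n G)}
                  (A-max : MaximalIndependent G A) (Q-max : MaximalCliqueDminus G A Q) where

  open Diameter diam

  private
    variable
      i : ℕ
      v : V G

  O : Subset (n G)
  O = ∁ (A ∪ Q)

  Q∉A : v ∈ Q → v ∉ A
  Q∉A = proj₁ (proj₁ Q-max) _

  O∉A : v ∈ O → v ∉ A
  O∉A v∈O v∈A = x∈∁p⇒x∉p v∈O (x∈p∪q⁺ (inj₁ v∈A))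

  O∉Q : v ∈ O → v ∉ Q
  O∉Q v∈O v∈Q = x∈∁p⇒x∉p v∈O (x∈p∪q⁺ (inj₂ v∈Q))

  ∣O∣≡n∸[∣A∣+∣Q∣] : ∣ O ∣ ≡ n G ∸ (∣ A ∣ + ∣ Q ∣)
  ∣O∣≡n∸[∣A∣+∣Q∣] = ∣∁[p∪q]∣≡n∸[∣p∣+∣q∣] (λ v∈A v∈Q → Q∉A v∈Q v∈A)

  color : V G → ℕ
  color v with v ∈? A | v ∈? Q
  ... | yes _ | _     = 1
  ... | no _  | yes _ = 2
  ... | no _  | no _  = 3 + rank O v

  data Color (v : V G) : ℕ → Set where
    color-A : v ∈ A → Color v 1
    color-Q : v ∈ Q → Color v 2
    color-O : v ∈ O → Color v (3 + rank O v)

  color-view : ∀ v → Color v (color v)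
  color-view v with v ∈? A | v ∈? Q
  ... | yes v∈A | _       = color-A v∈A
  ... | no _    | yes v∈Q = color-Q v∈Q
  ... | no v∉A  | no v∉Q  = color-O (x∉p⇒x∈∁p ([ v∉A , v∉Q ]′ ∘ x∈p∪q⁻ A Q))

  Color-unique : ∀ {j} → Color v i → Color v j → i ≡ j
  Color-unique (color-A _)   (color-A _)   = refl
  Color-unique (color-A v∈A) (color-Q v∈Q) = contradiction v∈A (Q∉A v∈Q)
  Color-unique (color-A v∈A) (color-O v∈O) = contradiction v∈A (O∉A v∈O)
  Color-unique (color-Q v∈Q) (color-A v∈A) = contradiction v∈A (Q∉A v∈Q)
  Color-unique (color-Q _)   (color-Q _)   = refl
  Color-unique (color-Q v∈Q) (color-O v∈O) = contradiction v∈Q (O∉Q v∈O)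
  Color-unique (color-O v∈O) (color-A v∈A) = contradiction v∈A (O∉A v∈O)
  Color-unique (color-O v∈O) (color-Q v∈Q) = contradiction v∈Q (O∉Q v∈O)
  Color-unique (color-O _)   (color-O _)   = refl

  color-≡ : Color v i → color v ≡ i
  color-≡ = Color-unique (color-view _)

  color≡1⇒∈A : color v ≡ 1 → v ∈ A
  color≡1⇒∈A {v} eq with subst (Color v) eq (color-view v)
  ... | color-A v∈A = v∈A

  color≡2⇒∈Q : color v ≡ 2 → v ∈ Q
  color≡2⇒∈Q {v} eq with subst (Color v) eq (color-view v)
  ... | color-Q v∈Q = v∈Q

  color≡3+i⇒∈O : color v ≡ 3 + i → v ∈ O × rank O v ≡ i
  color≡3+i⇒∈O {v} eq with subst (Color v) eq (color-view v)
  ... | color-O v∈O = v∈O , refl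

  Color-range : Color v i → 1 ≤ i × i ≤ 2 + ∣ O ∣
  Color-range (color-A _)   = s≤s z≤n , s≤s z≤n
  Color-range (color-Q _)   = s≤s z≤n , s≤s (s≤s z≤n)
  Color-range (color-O v∈O) = s≤s z≤n , s≤s (s≤s (rank<∣p∣ v∈O))

  Color>1⇒∉A : Color v i → 1 < i → v ∉ A
  Color>1⇒∉A (color-A _)   (s≤s ())
  Color>1⇒∉A (color-Q v∈Q) _ = Q∉A v∈Q
  Color>1⇒∉A (color-O v∈O) _ = O∉A v∈O

  Color>2⇒∈O : Color v i → 2 < i → v ∈ O
  Color>2⇒∈O (color-A _)   (s≤s ())
  Color>2⇒∈O (color-Q _)   (s≤s (s≤s ()))
  Color>2⇒∈O (color-O v∈O) _ = v∈O

  color-surjective : ∀ i → 1 ≤ i → i ≤ 2 + ∣ O ∣ → ∃[ v ] color v ≡ i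
  color-surjective 1 _ _ =
    let v , v∈A = maximalIndependent-nonempty {G = G} A-max vertex in v , color-≡ (color-A v∈A)
  color-surjective 2 _ _ =
    let v , v∉A = independent⇒∃∉ {A = A} (proj₁ A-max)
        u , u∈Q = maximalClique-nonempty Q-max v∉A
    in  u , color-≡ (color-Q u∈Q)
  color-surjective (suc (suc (suc i))) _ (s≤s (s≤s i<∣O∣)) with rank-surjective {p = O} i<∣O∣
  ... | v , v∈O , refl = v , color-≡ (color-O v∈O)

  packing : Packing G color
  packing = classes⇒packing
    (λ u v cu cv → proj₁ A-max u v (color≡1⇒∈A cu) (color≡1⇒∈A cv))
    (λ u v u≢v cu cv → DiamPair⇒far (proj₂ (proj₁ Q-max) u v (color≡2⇒∈Q cu) (color≡2⇒∈Q cv) u≢v))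
    (λ u v i cu cv → let u∈O , ru = color≡3+i⇒∈O cu
                         v∈O , rv = color≡3+i⇒∈O cv
                     in  rank-injective u∈O v∈O (trans ru (sym rv)))

  grundy : GrundyCond G color
  grundy v 1 _ 1<cv =
    let u , u∈A , e = maximalIndependent⇒dominating {G = G} A-max (Color>1⇒∉A (color-view v) 1<cv)
    in  u , color-≡ (color-A u∈A) , Edge⇒Dist≤1 e
  grundy v 2 _ 2<cv =
    let v∈O     = Color>2⇒∈O (color-view v) 2<cv
        u , u∈Q , close = maximalClique⇒near Q-max (O∉A v∈O) (O∉Q v∈O)
    in  u , color-≡ (color-Q u∈Q) , close
  grundy v (suc (suc (suc j))) _ j<cv =
    let u , cu = color-surjective (3 + j) (s≤s z≤n) 3+j≤2+∣O∣
    in  u , cu , Dist≤-mono (s≤s (s≤s (s≤s z≤n))) (within-diam u v)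
    where
    3+j≤2+∣O∣ : 3 + j ≤ 2 + ∣ O ∣
    3+j≤2+∣O∣ = ≤-trans (<⇒≤ j<cv) (proj₂ (Color-range (color-view v)))

  coloring : GrundyPackingColoring G (2 + ∣ O ∣) color
  coloring = ((λ v → Color-range (color-view v)) , color-surjective) , packing , grundy

module UpperBound {G : Graph} (diam : Diam G 3) {k : ℕ} {c : V G → ℕ}
                  (gpc : GrundyPackingColoring G k c) where

  open Diameter diam

  private
    variable
      v : V G

  A : Subset (n G)
  A = subsetOf (λ v → c v ≟ⁿ 1)

  Q : Subset (n G)
  Q = subsetOf (λ v → c v ≟ⁿ 2)

  O : Subset (n G)
  O = ∁ (A ∪ Q)

  ∈A⇒c≡1 : v ∈ A → c v ≡ 1
  ∈A⇒c≡1 = ∈-subsetOf⁻ _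

  ∈Q⇒c≡2 : v ∈ Q → c v ≡ 2
  ∈Q⇒c≡2 = ∈-subsetOf⁻ _

  c-range : ∀ v → 1 ≤ c v × c v ≤ k
  c-range = proj₁ (proj₁ gpc)

  c-surjective : ∀ i → 1 ≤ i → i ≤ k → ∃[ v ] c v ≡ i
  c-surjective = proj₂ (proj₁ gpc)

  packing : Packing G c
  packing = proj₁ (proj₂ gpc)

  smaller-color : ∀ v j → 1 ≤ j → j < c v → ∃[ u ] (u ≢ v × c u ≡ j × Dist≤ G j u v)
  smaller-color v j 1≤j j<cv =
    let u , cu≡j , close = proj₂ (proj₂ gpc) v j 1≤j j<cv
    in  u , (λ u≡v → <-irrefl (trans (sym cu≡j) (cong c u≡v)) j<cv) , cu≡j , close

  ∉A⇒1<c : v ∉ A → 1 < c v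
  ∉A⇒1<c {v} v∉A = ≤∧≢⇒< (proj₁ (c-range v)) (v∉A ∘ ∈-subsetOf⁺ _ ∘ sym)

  ∉A∪Q⇒2<c : v ∉ A → v ∉ Q → 2 < c v
  ∉A∪Q⇒2<c v∉A v∉Q = ≤∧≢⇒< (∉A⇒1<c v∉A) (v∉Q ∘ ∈-subsetOf⁺ _ ∘ sym)

  A-independent : Independent G A
  A-independent x y x∈A y∈A with x ≟ᶠ y
  ... | yes refl = irref G x
  ... | no x≢y   = ¬-not λ e → Packing⇒apart packing (∈A⇒c≡1 x∈A) (∈A⇒c≡1 y∈A) x≢y (Edge⇒Dist≤1 e)

  A-maximal : MaximalIndependent G A
  A-maximal = A-independent , maximal
    where
    maximal : ∀ B → Independent G B → A ⊆ B → B ⊆ A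
    maximal B B-independent A⊆B {v} v∈B with v ∈? A
    ... | yes v∈A = v∈A
    ... | no v∉A  =
      let u , u≢v , cu≡1 , close = smaller-color v 1 ≤-refl (∉A⇒1<c v∉A)
      in  contradiction (B-independent u v (A⊆B (∈-subsetOf⁺ _ cu≡1)) v∈B)
                        (not-¬ (Dist≤1⇒Edge u≢v close))

  Q-clique : CliqueDminus G A Q
  Q-clique = (λ x x∈Q x∈A → contradiction (trans (sym (∈Q⇒c≡2 x∈Q)) (∈A⇒c≡1 x∈A)) λ ())
           , λ x y x∈Q y∈Q x≢y → far⇒DiamPair (Packing⇒apart packing (∈Q⇒c≡2 x∈Q) (∈Q⇒c≡2 y∈Q) x≢y)

  Q-maximal : MaximalCliqueDminus G A Q
  Q-maximal = Q-clique , maximal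
    where
    maximal : ∀ Q′ → CliqueDminus G A Q′ → Q ⊆ Q′ → Q′ ⊆ Q
    maximal Q′ (Q′∩A=∅ , Q′-clique) Q⊆Q′ {v} v∈Q′ with v ∈? Q
    ... | yes v∈Q = v∈Q
    ... | no v∉Q  =
      let u , u≢v , cu≡2 , close = smaller-color v 2 (s≤s z≤n) (∉A∪Q⇒2<c (Q′∩A=∅ v v∈Q′) v∉Q)
      in  contradiction close (DiamPair⇒far (Q′-clique u v (Q⊆Q′ (∈-subsetOf⁺ _ cu≡2)) v∈Q′ u≢v))

  ∣O∣≡n∸[∣A∣+∣Q∣] : ∣ O ∣ ≡ n G ∸ (∣ A ∣ + ∣ Q ∣)
  ∣O∣≡n∸[∣A∣+∣Q∣] = ∣∁[p∪q]∣≡n∸[∣p∣+∣q∣] λ v∈A v∈Q →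
    contradiction (trans (sym (∈A⇒c≡1 v∈A)) (∈Q⇒c≡2 v∈Q)) λ ()

  colored : Fin (k ∸ 2) → V G
  colored i = proj₁ (c-surjective (3 + toℕ i) (s≤s z≤n) (m<n∸o⇒o+m<n 2 k (toℕ<n i)))

  c∘colored : ∀ i → c (colored i) ≡ 3 + toℕ i
  c∘colored i = proj₂ (c-surjective (3 + toℕ i) (s≤s z≤n) (m<n∸o⇒o+m<n 2 k (toℕ<n i)))

  colored-injective : Injective _≡_ _≡_ colored
  colored-injective {i} {j} eq =
    toℕ-injective (+-cancelˡ-≡ 3 _ _ (trans (sym (c∘colored i)) (trans (cong c eq) (c∘colored j))))

  colored∈O : ∀ i → colored i ∈ O
  colored∈O i = x∉p⇒x∈∁p ([ (λ v∈A → contradiction (trans (sym (c∘colored i)) (∈A⇒c≡1 v∈A)) λ ())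
                           , (λ v∈Q → contradiction (trans (sym (c∘colored i)) (∈Q⇒c≡2 v∈Q)) λ ())
                           ]′ ∘ x∈p∪q⁻ A Q)

  k≤2+∣O∣ : k ≤ 2 + ∣ O ∣
  k≤2+∣O∣ = ≤-trans (m≤n+m∸n k 2) (+-monoʳ-≤ 2 (injective⇒≤∣p∣ colored colored-injective colored∈O))

module _ {G : Graph} (diam : Diam G 3) {m : ℕ} (is-m : IsM G m) where

  Grundy-packing-coloring : ∃[ c ] GrundyPackingColoring G ((n G ∸ m) + 2) c
  Grundy-packing-coloring with proj₁ is-m
  ... | A , Q , A-max , (Q-max , _) , ∣A∣+∣Q∣≡m =
    color , subst (λ k → GrundyPackingColoring G k color) colors≡ coloring
    where
    open LowerBound diam A-max Q-max
    open ≡-Reasoning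
    colors≡ : 2 + ∣ O ∣ ≡ (n G ∸ m) + 2
    colors≡ = begin
      2 + ∣ O ∣                    ≡⟨ cong (2 +_) ∣O∣≡n∸[∣A∣+∣Q∣] ⟩
      2 + (n G ∸ (∣ A ∣ + ∣ Q ∣))  ≡⟨ cong (λ a → 2 + (n G ∸ a)) ∣A∣+∣Q∣≡m ⟩
      2 + (n G ∸ m)                ≡⟨ +-comm 2 (n G ∸ m) ⟩
      (n G ∸ m) + 2                ∎

  Grundy-packing-colors≤ : ∀ k c → GrundyPackingColoring G k c → k ≤ (n G ∸ m) + 2
  Grundy-packing-colors≤ k c gpc = begin
    k                            ≤⟨ k≤2+∣O∣ ⟩
    2 + ∣ O ∣                    ≡⟨ cong (2 +_) ∣O∣≡n∸[∣A∣+∣Q∣] ⟩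
    2 + (n G ∸ (∣ A ∣ + ∣ Q ∣))  ≤⟨ +-monoʳ-≤ 2 (∸-monoʳ-≤ (n G) m≤∣A∣+∣Q∣) ⟩
    2 + (n G ∸ m)                ≡⟨ +-comm 2 (n G ∸ m) ⟩
    (n G ∸ m) + 2                ∎
    where
    open UpperBound diam gpc
    open ≤-Reasoning
    m≤∣A∣+∣Q∣ : m ≤ ∣ A ∣ + ∣ Q ∣
    m≤∣A∣+∣Q∣ = IsM⇒m≤∣A∣+∣Q∣ is-m A-maximal Q-maximal

theorem13 : (G : Graph) → Diam G 3 → (m : ℕ) → IsM G m
            → IsGrundyPackingNumber G ((n G ∸ m) + 2)
theorem13 G diam m is-m = Grundy-packing-coloring diam is-m , Grundy-packing-colors≤ diam is-m
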